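{- Let $X$ be a space and let $\Gamma_{SI}(X)$ be the set of all $SI$-closed subsets of $X$, endowed with the topology generated by the subbasic open sets $\Diamond U := \{C \in \Gamma_{SI}(X) \mid C \cap U \neq \emptyset\}$, where $U$ ranges over the $SI$-open subsets of $X$. Then (1) the specialization order on $\Gamma_{SI}(X)$ is set inclusion, and (2) $\Gamma_{SI}(X)$ is a strongly complete space.
   Context: All spaces are $T_0$ topological spaces. For a space $X$, the specialization order is $x \leq y$ iff every open set containing $x$ contains $y$; suprema refer to this order. A nonempty subset $F$ of $X$ is irreducible if whenever $F \subseteq A \cup B$ with $A, B$ closed, then $F \subseteq A$ or $F \subseteq B$; $\operatorname{Irr}(X)$ denotes the set of irreducible subsets and $\operatorname{Irr}^{+}(X)$ those $F \in \operatorname{Irr}(X)$ whose supremum $\bigvee F$ exists in $X$. A subset $U$ of $X$ is $SI$-open if $U$ is open and for every $F \in \operatorname{Irr}^{+}(X)$ with $\bigvee F \in U$ one has $F \cap U \neq \emptyset$; complements of $SI$-open sets are $SI$-closed. A space $Y$ is strongly complete if every irreducible subset of $Y$ has a supremum, i.e. $\operatorname{Irr}(Y) = \operatorname{Irr}^{+}(Y)$. -}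

module Defs where

open import Level using (Level; _⊔_; suc; Lift)
open import Data.Product using (Σ; ∃; ∃-syntax; _×_; _,_; proj₁; proj₂)
open import Data.Sum using (_⊎_)
open import Data.Unit using (⊤)
open import Relation.Nullary using (¬_)
open import Relation.Unary using (Pred; _∩_; _∪_; _⊆_; _≐_; ∁)
open import Relation.Binary.PropositionalEquality using (_≡_)
open import Function.Bundles using (_⇔_)

module _ {a b c : Level} {P : Set a} (Open : Pred (Pred P b) c) where

  SpecLe : P → P → Set (a ⊔ suc b ⊔ c)
  SpecLe x y = ∀ (U : Pred P b) → Open U → U x → U y

  Closed : Pred (Pred P b) (a ⊔ suc b ⊔ c)
  Closed A = ∃[ U ] (Open U × (A ≐ ∁ U))

  Irreducible : Pred (Pred P b) (a ⊔ suc b ⊔ c)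
  Irreducible F =
    (∃[ x ] F x) ×
    (∀ (A B : Pred P b) → Closed A → Closed B → F ⊆ (A ∪ B) → (F ⊆ A) ⊎ (F ⊆ B))

  IsSup : Pred P b → P → Set (a ⊔ suc b ⊔ c)
  IsSup F s = (∀ x → F x → SpecLe x s) × (∀ u → (∀ x → F x → SpecLe x u) → SpecLe s u)

  HasSup : Pred P b → Set (a ⊔ suc b ⊔ c)
  HasSup F = ∃[ s ] IsSup F s

  StronglyComplete : Set (a ⊔ suc b ⊔ c)
  StronglyComplete = ∀ (F : Pred P b) → Irreducible F → HasSup F

-- T0 topological spaces.  Open sets are predicates of level ℓ on a
-- carrier of level ℓ; the union axiom allows families indexed by
-- types of level suc ℓ (classically: arbitrary unions).

record Space (ℓ : Level) : Set (suc (suc ℓ)) where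
  field
    Carrier   : Set ℓ
    Open      : Pred (Pred Carrier ℓ) ℓ
    open-resp : ∀ {U V : Pred Carrier ℓ} → U ≐ V → Open U → Open V
    open-⊤    : Open (λ _ → Lift ℓ ⊤)
    open-∩    : ∀ {U V : Pred Carrier ℓ} → Open U → Open V → Open (U ∩ V)
    open-⋃    : (I : Set (suc ℓ)) (f : I → Pred Carrier ℓ) → (∀ i → Open (f i)) →
                Σ (Pred Carrier ℓ) (λ W → Open W × (∀ x → W x ⇔ (∃[ i ] f i x)))
    T0        : ∀ x y → SpecLe Open x y → SpecLe Open y x → x ≡ y

data GenOpen {a ℓ c : Level} {Y : Set a} (S : Pred (Pred Y ℓ) c) :
       Pred (Pred Y ℓ) (a ⊔ suc ℓ ⊔ c) where
  sub   : ∀ {U} → S U → GenOpen S U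
  top   : GenOpen S (λ _ → Lift ℓ ⊤)
  inter : ∀ {U V} → GenOpen S U → GenOpen S V → GenOpen S (U ∩ V)
  union : (I : Set ℓ) (f : I → Pred Y ℓ) → (∀ i → GenOpen S (f i)) →
          GenOpen S (λ y → ∃[ i ] f i y)
  resp  : ∀ {U V} → U ≐ V → GenOpen S U → GenOpen S V

module _ {ℓ : Level} (X : Space ℓ) where
  open Space X

  SIOpen : Pred (Pred Carrier ℓ) (suc ℓ)
  SIOpen U = Open U ×
    (∀ (F : Pred Carrier ℓ) → Irreducible Open F → ∀ s → IsSup Open F s → U s →
       ∃[ x ] (F x × U x))

  SIClosed : Pred (Pred Carrier ℓ) (suc ℓ)
  SIClosed C = ∃[ U ] (SIOpen U × (C ≐ ∁ U))

  ΓSI : Set (suc ℓ)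
  ΓSI = Σ (Pred Carrier ℓ) SIClosed

  ◇ : Pred Carrier ℓ → Pred ΓSI (suc ℓ)
  ◇ U C = Lift (suc ℓ) (∃[ x ] (proj₁ C x × U x))

  ΓSubbasic : Pred (Pred ΓSI (suc ℓ)) (suc ℓ)
  ΓSubbasic 𝒪 = ∃[ U ] (SIOpen U × (𝒪 ≐ ◇ U))

  ΓOpen : Pred (Pred ΓSI (suc ℓ)) (suc (suc ℓ))
  ΓOpen = GenOpen ΓSubbasic

-- Every open set of Γ_SI(X) is generated from the subbasic sets ◇U, each of
-- which is upward closed for inclusion; hence all opens are up-sets and
-- C ⊆ D implies C ≤ D.  Conversely, if C ≤ D and x ∈ C lay in the SI-open
-- complement U of D, then C ∈ ◇U, so D ∈ ◇U, which is absurd; thus C ⊆ D.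
--
-- For strong completeness we show more: every family 𝓕 of SI-closed sets
-- has a supremum (no irreducibility and no excluded middle are needed).
-- SI-open sets are closed under arbitrary unions, so the union W of all
-- SI-open sets disjoint from every member of 𝓕 is SI-open; its complement
-- is the least SI-closed set containing every member of 𝓕.  Since the
-- specialization order is inclusion, this is the supremum of 𝓕.

module Submission where

open import Defs
open import Level using (Level; lift)
open import Data.Product using (_×_; proj₁; proj₂; _,_; Σ; ∃-syntax)
open import Relation.Nullary using (¬_)
open import Relation.Unary using (_⊆_; Pred; ∁)
open import Function.Base using (id)
open import Function.Bundles using (_⇔_; mk⇔; Equivalence)
open import Axiom.ExcludedMiddle using (ExcludedMiddle)

module _ {ℓ : Level} (X : Space ℓ) where
  open Space X
  open Equivalence

  ΓOpen-upward : ∀ {𝒪} → ΓOpen X 𝒪 → ∀ {C D : ΓSI X} → proj₁ C ⊆ proj₁ D → 𝒪 C → 𝒪 D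
  ΓOpen-upward (sub (U , _ , 𝒪≐◇U)) C⊆D C∈𝒪 with proj₁ 𝒪≐◇U C∈𝒪
  ... | lift (x , x∈C , x∈U) = proj₂ 𝒪≐◇U (lift (x , C⊆D x∈C , x∈U))
  ΓOpen-upward top           C⊆D C∈𝒪       = C∈𝒪
  ΓOpen-upward (inter g h)   C⊆D (C∈𝒪 , C∈𝒫) = ΓOpen-upward g C⊆D C∈𝒪 , ΓOpen-upward h C⊆D C∈𝒫
  ΓOpen-upward (union I f g) C⊆D (i , C∈fi) = i , ΓOpen-upward (g i) C⊆D C∈fi
  ΓOpen-upward (resp 𝒪≐𝒫 g) C⊆D C∈𝒫       = proj₁ 𝒪≐𝒫 (ΓOpen-upward g C⊆D (proj₂ 𝒪≐𝒫 C∈𝒫))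

  -- If C ≤ D then C ⊆ D: test the specialization against ◇U, where U is
  -- the SI-open complement of D.
  specialization⇒⊆ : ∀ (C D : ΓSI X) → SpecLe (ΓOpen X) C D → proj₁ C ⊆ proj₁ D
  specialization⇒⊆ C (D , U , siU , D≐∁U) C≤D {x} x∈C = proj₂ D≐∁U x∉U
    where
    x∉U : ¬ U x
    x∉U x∈U with C≤D (◇ X U) (sub (U , siU , id , id)) (lift (x , x∈C , x∈U))
    ... | lift (y , y∈D , y∈U) = proj₁ D≐∁U y∈D y∈U

  specialization⇔⊆ : ∀ (C D : ΓSI X) → SpecLe (ΓOpen X) C D ⇔ (proj₁ C ⊆ proj₁ D)
  specialization⇔⊆ C D =
    mk⇔ (specialization⇒⊆ C D) (λ C⊆D 𝒪 𝒪-open → ΓOpen-upward 𝒪-open C⊆D)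

  -- SI-open sets are closed under unions: a point of an irreducible set's
  -- supremum in the union lies in some member, which the set must meet.
  SIOpen-⋃ : (I : Set (Level.suc ℓ)) (f : I → Pred Carrier ℓ) → (∀ i → SIOpen X (f i)) →
             Σ (Pred Carrier ℓ) (λ W → SIOpen X W × (∀ x → W x ⇔ (∃[ i ] f i x)))
  SIOpen-⋃ I f f-SIOpen = W , (W-open , W-SI) , W⇔⋃
    where
    ⋃f : Σ (Pred Carrier ℓ) (λ W → Open W × (∀ x → W x ⇔ (∃[ i ] f i x)))
    ⋃f = open-⋃ I f (λ i → proj₁ (f-SIOpen i))
    W : Pred Carrier ℓ
    W = proj₁ ⋃f
    W-open : Open W
    W-open = proj₁ (proj₂ ⋃f)
    W⇔⋃ : ∀ x → W x ⇔ (∃[ i ] f i x)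
    W⇔⋃ = proj₂ (proj₂ ⋃f)
    W-SI : ∀ F → Irreducible Open F → ∀ s → IsSup Open F s → W s → ∃[ x ] (F x × W x)
    W-SI F F-irr s s-sup s∈W with to (W⇔⋃ s) s∈W
    ... | i , s∈fi with proj₂ (f-SIOpen i) F F-irr s s-sup s∈fi
    ...   | x , x∈F , x∈fi = x , x∈F , from (W⇔⋃ x) (i , x∈fi)

  module SIClosureOfUnion (𝓕 : Pred (ΓSI X) (Level.suc ℓ)) where

    AvoidsAll : Pred Carrier ℓ → Set (Level.suc ℓ)
    AvoidsAll U = ∀ C → 𝓕 C → ∀ x → proj₁ C x → ¬ U x

    Avoiding : Set (Level.suc ℓ)
    Avoiding = Σ (Pred Carrier ℓ) (λ U → SIOpen X U × AvoidsAll U)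

    ⋃Avoiding : Σ (Pred Carrier ℓ) (λ W → SIOpen X W × (∀ x → W x ⇔ (∃[ i ] proj₁ i x)))
    ⋃Avoiding = SIOpen-⋃ Avoiding proj₁ (λ i → proj₁ (proj₂ i))

    W : Pred Carrier ℓ
    W = proj₁ ⋃Avoiding

    W⇔⋃ : ∀ x → W x ⇔ (∃[ i ] proj₁ i x)
    W⇔⋃ = proj₂ (proj₂ ⋃Avoiding)

    closure : ΓSI X
    closure = ∁ W , W , proj₁ (proj₂ ⋃Avoiding) , id , id

    member⊆closure : ∀ C → 𝓕 C → proj₁ C ⊆ proj₁ closure
    member⊆closure C C∈𝓕 {x} x∈C x∈W with to (W⇔⋃ x) x∈W
    ... | (U , _ , U-avoids) , x∈U = U-avoids C C∈𝓕 x x∈C x∈U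

    -- The SI-open complement of any SI-closed upper bound T avoids 𝓕, so
    -- it lies inside W, i.e. the closure lies inside T.
    closure⊆bound : (T : ΓSI X) → (∀ C → 𝓕 C → proj₁ C ⊆ proj₁ T) → proj₁ closure ⊆ proj₁ T
    closure⊆bound (T , V , siV , T≐∁V) C⊆T {x} x∉W = proj₂ T≐∁V x∉V
      where
      V-avoids : AvoidsAll V
      V-avoids C C∈𝓕 y y∈C = proj₁ T≐∁V (C⊆T C C∈𝓕 y∈C)
      x∉V : ¬ V x
      x∉V x∈V = x∉W (from (W⇔⋃ x) ((V , siV , V-avoids) , x∈V))

  ΓSI-complete : ∀ (𝓕 : Pred (ΓSI X) (Level.suc ℓ)) → HasSup (ΓOpen X) 𝓕
  ΓSI-complete 𝓕 = closure , upper , least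
    where
    open SIClosureOfUnion 𝓕
    upper : ∀ C → 𝓕 C → SpecLe (ΓOpen X) C closure
    upper C C∈𝓕 = from (specialization⇔⊆ C closure) (member⊆closure C C∈𝓕)
    least : ∀ T → (∀ C → 𝓕 C → SpecLe (ΓOpen X) C T) → SpecLe (ΓOpen X) closure T
    least T C≤T = from (specialization⇔⊆ closure T)
      (closure⊆bound T (λ C C∈𝓕 → specialization⇒⊆ C T (C≤T C C∈𝓕)))

-- Lemma 4.3.
lemma4p3 : (∀ {p} → ExcludedMiddle p) → ∀ {ℓ : Level} (X : Space ℓ) →
    (∀ (C D : ΓSI X) → SpecLe (ΓOpen X) C D ⇔ (proj₁ C ⊆ proj₁ D))
    × StronglyComplete (ΓOpen X)
lemma4p3 _ X = specialization⇔⊆ X , λ 𝓕 _ → ΓSI-complete X 𝓕
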